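{- Let $({\cal F},\tau)$ be an oriented Fano plane with canonical composition factor $\epsilon^\tau$, and $\delta^\ast$ computed using $\epsilon^\tau$. Consider the eight functions ${\cal F}^\ast\to\{\pm1\}$ consisting of the constant function $1$ and, for each $P\in{\cal F}$, the function $D\mapsto1$ if $P\in D$, $D\mapsto-1$ if $P\notin D$. For each of these eight functions $f$ there are exactly $21$ elements $g\in\mathrm{Aut}({\cal F})$ such that $\delta^\ast(g,\cdot)=f$.
   Context: ${\cal F}$ is a Fano plane (seven points, seven lines), ${\cal F}^\ast$ its set of lines; $\mathrm{Aut}({\cal F})$ (of order 168) is the group of bijections sending lines to lines. An orientation is $\tau\in\mathrm{Aut}({\cal F})$ of order seven. The canonical composition factor: fix $P_0$, and for distinct $R=\tau^i(P_0)$, $S=\tau^j(P_0)$, $\epsilon^\tau_{RS}=1$ if $j-i\equiv1,2,4\pmod7$ and $-1$ if $j-i\equiv3,5,6\pmod7$. For $g\in\mathrm{Aut}({\cal F})$ and a line $D$, $\delta^\ast(g,D)=\epsilon^\tau_{PQ}\epsilon^\tau_{g(P)g(Q)}$ for any distinct $P,Q\in D$ (independent of the choice). -}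

module Defs where

open import Data.Bool using (Bool; true; false; T; if_then_else_)
open import Data.Fin using (Fin; toℕ) renaming (_≟_ to _≟ᶠ_)
open import Data.Nat using (ℕ; zero; suc; _+_; _∸_; _≤_; _<_)
open import Data.Nat.DivMod using (_%_)
open import Data.List using (List; length; filterᵇ; allFin)
open import Data.List.Relation.Unary.All using (All)
open import Data.List.Relation.Unary.Any using (Any)
open import Data.List.Relation.Unary.AllPairs using (AllPairs)
open import Data.Product using (Σ; ∃; _×_; _,_)
open import Data.Sign using (Sign) renaming (_*_ to _*ˢ_)
open import Function using (id; _∘_)
open import Function.Definitions using (Bijective)
open import Relation.Binary.PropositionalEquality using (_≡_; _≢_)
open import Relation.Nullary using (¬_; yes; no)

-- Points of the Fano plane are Fin 7, lines are indexed by Fin 7;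
-- inc P D = true  iff  point P lies on line D.
record FanoPlane : Set where
  field
    inc    : Fin 7 → Fin 7 → Bool
    three  : ∀ (D : Fin 7) → length (filterᵇ (λ P → inc P D) (allFin 7)) ≡ 3
    unique : ∀ (P Q : Fin 7) → P ≢ Q →
             Σ (Fin 7) λ D → T (inc P D) × T (inc Q D) ×
               (∀ (E : Fin 7) → T (inc P E) → T (inc Q E) → E ≡ D)

open FanoPlane public

IsAut : FanoPlane → (Fin 7 → Fin 7) → Set
IsAut F g = Bijective _≡_ _≡_ g ×
            (∀ (D : Fin 7) → Σ (Fin 7) λ E → ∀ (P : Fin 7) → inc F P D ≡ inc F (g P) E)

iter : ℕ → (Fin 7 → Fin 7) → Fin 7 → Fin 7
iter zero    t = id
iter (suc k) t = t ∘ iter k t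

HasOrder7 : (Fin 7 → Fin 7) → Set
HasOrder7 t = (∀ P → iter 7 t P ≡ P) ×
              (∀ k → 1 ≤ k → k < 7 → ¬ (∀ P → iter k t P ≡ P))

IsOrientation : FanoPlane → (Fin 7 → Fin 7) → Set
IsOrientation F t = IsAut F t × HasOrder7 t

-- least i < 7 with τ^i(P0) = R (searching i = 0,1,...,6); 0 if none
-- (for an orientation such an i always exists)
index : (Fin 7 → Fin 7) → Fin 7 → Fin 7 → ℕ
index t P0 R = go 0 7
  where
  go : ℕ → ℕ → ℕ
  go i zero    = 0
  go i (suc n) with iter i t P0 ≟ᶠ R
  ... | yes _ = i
  ... | no  _ = go (suc i) n

-- Canonical composition factor ε^τ_{RS} (relative to base point P0):
-- with R = τ^i(P0), S = τ^j(P0), it is +1 if j - i ≡ 1,2,4 (mod 7) and -1 otherwise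
-- (for R ≠ S "otherwise" means j - i ≡ 3,5,6 (mod 7)).
signOfDiff : ℕ → Sign
signOfDiff 1 = Sign.+
signOfDiff 2 = Sign.+
signOfDiff 4 = Sign.+
signOfDiff _ = Sign.-

eps : (Fin 7 → Fin 7) → Fin 7 → Fin 7 → Fin 7 → Sign
eps t P0 R S = signOfDiff (((index t P0 S + 7) ∸ index t P0 R) % 7)

DeltaIs : FanoPlane → (Fin 7 → Fin 7) → Fin 7 → (Fin 7 → Fin 7) → (Fin 7 → Sign) → Set
DeltaIs F t P0 g f = ∀ (D P Q : Fin 7) → P ≢ Q → T (inc F P D) → T (inc F Q D) →
                     (eps t P0 P Q *ˢ eps t P0 (g P) (g Q)) ≡ f D

_≐_ : (Fin 7 → Fin 7) → (Fin 7 → Fin 7) → Set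
g ≐ h = ∀ x → g x ≡ h x

ExactlyN : ℕ → FanoPlane → (Fin 7 → Fin 7) → Fin 7 → (Fin 7 → Sign) → Set
ExactlyN n F t P0 f =
  Σ (List (Fin 7 → Fin 7)) λ gs →
    (length gs ≡ n) ×
    All (λ g → IsAut F g × DeltaIs F t P0 g f) gs ×
    AllPairs (λ g h → ¬ (g ≐ h)) gs ×
    (∀ g → IsAut F g → DeltaIs F t P0 g f → Any (λ h → g ≐ h) gs)

constPlus : Fin 7 → Sign
constPlus _ = Sign.+

pointFun : FanoPlane → Fin 7 → Fin 7 → Sign
pointFun F P D = if inc F P D then Sign.+ else Sign.-

-- An orientation τ has order 7 on 7 points, so it is a 7-cycle and i ↦ τⁱ P0 identifies the points
-- with ℤ/7; ε^τ then depends only on differences in ℤ/7. The line through P0 and τ P0 is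
-- {0, 1, k} in these coordinates and its τ-translates are all the lines; since two points lie on
-- only one line, {0, 1, k} is a perfect difference set, so k ∈ {3, 5}. Hence every oriented Fano
-- plane is isomorphic to one of two cyclic models, and an isomorphism transports automorphisms
-- together with δ*. In a model an automorphism is determined by the images of 0, 1, 2, because
-- every point is obtained from these by taking third points of lines; so the automorphisms with
-- a prescribed δ* are counted by running through all 7³ images of (0, 1, 2). Translations of
-- ℤ/7 preserve ε^τ and reduce the seven functions D ↦ ±[P ∈ D] to the case P = 0.

module Submission where

open import Defs
open import Data.Bool using (Bool; true; false; T; if_then_else_) renaming (_≟_ to _≟ᵇ_)
open import Data.Bool.Properties using (T-≡)
open import Data.Empty using (⊥-elim)
open import Data.Fin using (Fin; zero; suc; toℕ; fromℕ<; punchOut)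
open import Data.Fin.Patterns using (0F; 1F; 2F; 3F; 4F; 5F; 6F)
open import Data.Fin.Permutation
  using (Permutation′; permutation; _⟨$⟩ʳ_; _⟨$⟩ˡ_; inverseʳ; inverseˡ; flip)
open import Data.Fin.Properties
  using (_≟_; all?; any?; injective⇒≤; punchOut-injective; toℕ<n; toℕ-fromℕ<; pigeonhole)
  renaming (<-cmp to <-cmpᶠ)
open import Data.List using (List; []; _∷_; length; lookup; map; filter; filterᵇ; allFin; cartesianProduct)
open import Data.List.Properties using (length-map)
open import Data.List.Membership.DecPropositional (_≟_ {7}) using (_∈?_)
open import Data.List.Membership.Propositional using (_∈_)
open import Data.List.Membership.Propositional.Properties
  using (∈-lookup; ∈-filter⁺; ∈-filter⁻; ∈-allFin; ∈-map⁺; ∈-cartesianProduct⁺)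
open import Data.List.Membership.Setoid.Properties using (index-injective)
open import Data.List.Relation.Unary.All as All using (All; []; _∷_)
import Data.List.Relation.Unary.All.Properties as All
open import Data.List.Relation.Unary.AllPairs as AllPairs using (AllPairs; []; _∷_; allPairs?)
import Data.List.Relation.Unary.AllPairs.Properties as AllPairs
open import Data.List.Relation.Unary.Any as Any using (Any; here; there)
import Data.List.Relation.Unary.Any.Properties as Any
open import Data.List.Relation.Unary.Unique.Propositional using (Unique)
import Data.List.Relation.Unary.Unique.Propositional.Properties as Unique
open import Data.Nat using (ℕ; zero; suc; _+_; _∸_; _*_; _≤_; _<_; s≤s; z≤n) renaming (_≟_ to _≟ℕ_)
open import Data.Nat.DivMod using (_%_; _/_; m%n<n; m≡m%n+[m/n]*n)
open import Data.Nat.Properties using (1+n≰n; <⇒≤; m∸n+n≡m; m∸n≤m; ≤-<-trans; m<n⇒0<n∸m; n<1+n)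
open import Data.Product using (Σ; ∃; _×_; _,_; proj₁; proj₂)
open import Data.Sign using (Sign) renaming (_*_ to _*ˢ_; _≟_ to _≟ˢ_)
open import Data.Vec using (_∷_; [])
import Data.Vec as Vec
open import Function using (_∘_)
open import Function.Bundles using (Equivalence)
open import Function.Consequences.Propositional using (strictlySurjective⇒surjective)
open import Function.Definitions using (Injective; StrictlySurjective; Bijective)
open import Relation.Binary.Definitions using (tri<; tri≈; tri>)
open import Relation.Binary.PropositionalEquality
open import Relation.Nullary using (Dec; yes; no; ¬_; contradiction)
open import Relation.Nullary.Decidable using (isYes; map′; ¬?; _×-dec_; _→-dec_; T?)

private variable
  A : Set
  n : ℕ

-- Decisions are run as `refl : isYes d ≡ true`: Agda's evaluator checks this far faster
-- than the equivalent `tt : True d`.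
from-isYes : {P : Set} (P? : Dec P) → isYes P? ≡ true → P
from-isYes (yes p) _ = p

¬T⇒≡false : ∀ {b} → ¬ T b → b ≡ false
¬T⇒≡false {false} _ = refl
¬T⇒≡false {true} ¬T = contradiction _ ¬T

injective⇒surjective : {f : Fin n → Fin n} → Injective _≡_ _≡_ f → StrictlySurjective _≡_ f
injective⇒surjective {zero}  f-inj ()
injective⇒surjective {suc n} {f} f-inj y with any? (λ x → f x ≟ y)
... | yes hit = hit
... | no miss = contradiction (injective⇒≤ punchOut∘f-injective) 1+n≰n
  where
  avoids : ∀ x → y ≢ f x
  avoids x y≡fx = miss (x , sym y≡fx)

  punchOut∘f-injective : Injective _≡_ _≡_ (λ x → punchOut (avoids x))
  punchOut∘f-injective eq = f-inj (punchOut-injective (avoids _) (avoids _) eq)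

injective⇒bijective : {f : Fin n → Fin n} → Injective _≡_ _≡_ f → Bijective _≡_ _≡_ f
injective⇒bijective f-inj = f-inj , strictlySurjective⇒surjective (injective⇒surjective f-inj)

injective⇒permutation : {f : Fin n → Fin n} → Injective _≡_ _≡_ f → Permutation′ n
injective⇒permutation {f = f} f-inj =
  permutation f (proj₁ ∘ surj) (proj₂ ∘ surj) (λ x → f-inj (proj₂ (surj (f x))))
  where surj = injective⇒surjective f-inj

injective? : (f : Fin n → Fin n) → Dec (Injective _≡_ _≡_ f)
injective? f = map′ (λ inj {x} {y} → inj x y) (λ inj x y → inj)
                    (all? λ x → all? λ y → f x ≟ f y →-dec x ≟ y)

lookup-injective : {xs : List A} → Unique xs → Injective _≡_ _≡_ (lookup xs)
lookup-injective (_ ∷ _)      {zero}  {zero}  _  = refl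
lookup-injective (x∉xs ∷ _)   {zero}  {suc j} eq = contradiction eq (All.lookup x∉xs (∈-lookup j))
lookup-injective (x∉xs ∷ _)   {suc i} {zero}  eq = contradiction (sym eq) (All.lookup x∉xs (∈-lookup i))
lookup-injective (_ ∷ unique) {suc i} {suc j} eq = cong suc (lookup-injective unique eq)

length-mono-⊆ : {xs ys : List A} → Unique xs → All (_∈ ys) xs → length xs ≤ length ys
length-mono-⊆ unique xs⊆ys = injective⇒≤ λ eq →
  lookup-injective unique (index-injective (setoid _) (member _) (member _) eq)
  where member = λ i → All.lookup xs⊆ys (∈-lookup i)

module _ (F : FanoPlane) where

  pointsOn : Fin 7 → List (Fin 7)
  pointsOn D = filterᵇ (λ P → inc F P D) (allFin 7)

  pointsOn-unique : ∀ D → Unique (pointsOn D)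
  pointsOn-unique D = Unique.filter⁺ (T? ∘ λ P → inc F P D) (Unique.allFin⁺ 7)

  ∈-pointsOn⁺ : ∀ {P D} → T (inc F P D) → P ∈ pointsOn D
  ∈-pointsOn⁺ {P} {D} = ∈-filter⁺ (T? ∘ λ P → inc F P D) (∈-allFin P)

  ∈-pointsOn⁻ : ∀ {P D} → P ∈ pointsOn D → T (inc F P D)
  ∈-pointsOn⁻ {D = D} = proj₂ ∘ ∈-filter⁻ (T? ∘ λ P → inc F P D)

  line-has-no-fourth-point : ∀ {D a b c x} → a ≢ b → a ≢ c → b ≢ c → x ≢ a → x ≢ b → x ≢ c →
                             T (inc F a D) → T (inc F b D) → T (inc F c D) → ¬ T (inc F x D)
  line-has-no-fourth-point {D} a≢b a≢c b≢c x≢a x≢b x≢c a∈D b∈D c∈D x∈D =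
    contradiction (subst (4 ≤_) (three F D) (length-mono-⊆ distinct on-D)) 1+n≰n
    where
    distinct : Unique (_ ∷ _ ∷ _ ∷ _ ∷ [])
    distinct = (a≢b ∷ a≢c ∷ x≢a ∘ sym ∷ []) ∷ (b≢c ∷ x≢b ∘ sym ∷ [])
             ∷ (x≢c ∘ sym ∷ []) ∷ [] ∷ []
    on-D = ∈-pointsOn⁺ a∈D ∷ ∈-pointsOn⁺ b∈D ∷ ∈-pointsOn⁺ c∈D ∷ ∈-pointsOn⁺ x∈D ∷ []

  line-has-third-point : ∀ {D a b} → a ≢ b → T (inc F a D) → T (inc F b D) →
                         ∃ λ c → T (inc F c D) × c ≢ a × c ≢ b
  line-has-third-point {D} {a} {b} a≢b a∈D b∈D
    with any? (λ c → T? (inc F c D) ×-dec ¬? (c ≟ a) ×-dec ¬? (c ≟ b))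
  ... | yes found = found
  ... | no none =
    contradiction (subst (_≤ 2) (three F D) (length-mono-⊆ (pointsOn-unique D) (All.tabulate in-ab))) 1+n≰n
    where
    in-ab : ∀ {c} → c ∈ pointsOn D → c ∈ a ∷ b ∷ []
    in-ab {c} c∈D with c ≟ a | c ≟ b
    ... | yes c≡a | _       = here c≡a
    ... | no _    | yes c≡b = there (here c≡b)
    ... | no c≢a  | no c≢b  = contradiction (c , ∈-pointsOn⁻ c∈D , c≢a , c≢b) none

  lines-through-two-points-coincide : ∀ {p q D E} → p ≢ q → T (inc F p D) → T (inc F q D) →
                                      T (inc F p E) → T (inc F q E) → D ≡ E
  lines-through-two-points-coincide p≢q p∈D q∈D p∈E q∈E =
    trans (on-line _ p∈D q∈D) (sym (on-line _ p∈E q∈E))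
    where on-line = proj₂ (proj₂ (proj₂ (unique F _ _ p≢q)))

  IsThirdPoint : (Fin 7 → Fin 7 → Fin 7) → Set
  IsThirdPoint third =
    (∀ p → third p p ≡ p) ×
    (∀ p q → p ≢ q → ∃ λ D → T (inc F p D) × T (inc F q D) × T (inc F (third p q) D) ×
                              third p q ≢ p × third p q ≢ q)

  isThirdPoint? : ∀ third → Dec (IsThirdPoint third)
  isThirdPoint? third =
    (all? λ p → third p p ≟ p) ×-dec
    (all? λ p → all? λ q → ¬? (p ≟ q) →-dec any? λ D →
       T? (inc F p D) ×-dec T? (inc F q D) ×-dec T? (inc F (third p q) D) ×-dec
       ¬? (third p q ≟ p) ×-dec ¬? (third p q ≟ q))

  automorphism-preserves-third : ∀ {third} → IsThirdPoint third → ∀ {h} → IsAut F h →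
                                 ∀ x y → h (third x y) ≡ third (h x) (h y)
  automorphism-preserves-third {third} (third-diagonal , third-collinear) {h} ((h-inj , _) , h-lines) x y =
    by-cases (x ≟ y)
    where
    by-cases : Dec (x ≡ y) → h (third x y) ≡ third (h x) (h y)
    by-cases (yes refl) = trans (cong h (third-diagonal x)) (sym (third-diagonal (h x)))
    by-cases (no x≢y) with third-collinear _ _ x≢y | third-collinear _ _ (x≢y ∘ h-inj)
    ... | D , x∈D , y∈D , t∈D , t≢x , t≢y | E , hx∈E , hy∈E , t′∈E , t′≢hx , t′≢hy
      with h (third x y) ≟ third (h x) (h y)
    ...   | yes ht≡t′ = ht≡t′
    ...   | no  ht≢t′ = contradiction (image t∈D)
              (line-has-no-fourth-point (x≢y ∘ h-inj) (t′≢hx ∘ sym) (t′≢hy ∘ sym)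
                 (t≢x ∘ h-inj) (t≢y ∘ h-inj) ht≢t′ hx∈E hy∈E t′∈E)
      where
      onImage : ∀ {P} → T (inc F P D) → T (inc F (h P) (proj₁ (h-lines D)))
      onImage {P} = subst T (proj₂ (h-lines D) P)

      image : ∀ {P} → T (inc F P D) → T (inc F (h P) E)
      image P∈D = subst (λ L → T (inc F (h _) L))
        (lines-through-two-points-coincide (x≢y ∘ h-inj) (onImage x∈D) (onImage y∈D) hx∈E hy∈E)
        (onImage P∈D)

infixl 7 _∙_

data Word : Set where
  gen₀ gen₁ gen₂ : Word
  _∙_ : Word → Word → Word

Triple : Set
Triple = Fin 7 × Fin 7 × Fin 7

map₃ : (Fin 7 → Fin 7) → Triple → Triple
map₃ h (a , b , c) = h a , h b , h c

evaluate : (Fin 7 → Fin 7 → Fin 7) → Triple → Word → Fin 7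
evaluate third (a , b , c) gen₀ = a
evaluate third (a , b , c) gen₁ = b
evaluate third (a , b , c) gen₂ = c
evaluate third v (w ∙ w′) = third (evaluate third v w) (evaluate third v w′)

module _ {F : FanoPlane} {third} (third-spec : IsThirdPoint F third) {h} (h-aut : IsAut F h) where

  automorphism-evaluate : ∀ (v : Triple) w → h (evaluate third v w) ≡ evaluate third (map₃ h v) w
  automorphism-evaluate v gen₀ = refl
  automorphism-evaluate v gen₁ = refl
  automorphism-evaluate v gen₂ = refl
  automorphism-evaluate v (w ∙ w′) = begin
    h (third (evaluate third v w) (evaluate third v w′))
      ≡⟨ automorphism-preserves-third F third-spec h-aut _ _ ⟩
    third (h (evaluate third v w)) (h (evaluate third v w′))
      ≡⟨ cong₂ third (automorphism-evaluate v w) (automorphism-evaluate v w′) ⟩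
    third (evaluate third (map₃ h v) w) (evaluate third (map₃ h v) w′) ∎
    where open ≡-Reasoning

module _ (F : FanoPlane) where

  PreservesLines : (Fin 7 → Fin 7) → Set
  PreservesLines g = ∀ D → Σ (Fin 7) λ E → ∀ P → inc F P D ≡ inc F (g P) E

  IsAut? : ∀ g → Dec (IsAut F g)
  IsAut? g = map′ fromInjective (λ ((g-inj , _) , g-lines) → g-inj , g-lines)
                  (injective? g ×-dec all? λ D → any? λ E → all? λ P → inc F P D ≟ᵇ inc F (g P) E)
    where
    fromInjective : Injective _≡_ _≡_ g × PreservesLines g → IsAut F g
    fromInjective (g-inj , g-lines) = injective⇒bijective g-inj , g-lines

  DeltaIs? : ∀ τ P0 g f → Dec (DeltaIs F τ P0 g f)
  DeltaIs? τ P0 g f = all? λ D → all? λ P → all? λ Q →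
    ¬? (P ≟ Q) →-dec T? (inc F P D) →-dec T? (inc F Q D) →-dec
    eps τ P0 P Q *ˢ eps τ P0 (g P) (g Q) ≟ˢ f D

  IsAut-resp-≐ : ∀ {g h} → g ≐ h → IsAut F g → IsAut F h
  IsAut-resp-≐ {g} {h} g≐h ((g-inj , _) , g-lines) =
      injective⇒bijective (λ eq → g-inj (trans (g≐h _) (trans eq (sym (g≐h _)))))
    , λ D → proj₁ (g-lines D) , λ P → trans (proj₂ (g-lines D) P) (cong (λ R → inc F R _) (g≐h P))

  DeltaIs-resp-≐ : ∀ {τ P0 g h f} → g ≐ h → DeltaIs F τ P0 g f → DeltaIs F τ P0 h f
  DeltaIs-resp-≐ {τ} {P0} {f = f} g≐h g-delta D P Q P≢Q P∈D Q∈D =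
    subst₂ (λ R S → eps τ P0 P Q *ˢ eps τ P0 R S ≡ f D) (g≐h P) (g≐h Q) (g-delta D P Q P≢Q P∈D Q∈D)

_≐?_ : (g h : Fin 7 → Fin 7) → Dec (g ≐ h)
g ≐? h = all? λ x → g x ≟ h x

⟨$⟩ʳ-injective : (π : Permutation′ n) → Injective _≡_ _≡_ (π ⟨$⟩ʳ_)
⟨$⟩ʳ-injective π eq = trans (sym (inverseˡ π)) (trans (cong (π ⟨$⟩ˡ_) eq) (inverseˡ π))

⟨$⟩ˡ-injective : (π : Permutation′ n) → Injective _≡_ _≡_ (π ⟨$⟩ˡ_)
⟨$⟩ˡ-injective π = ⟨$⟩ʳ-injective (flip π)

record Isomorphism (F′ : FanoPlane) (τ′ : Fin 7 → Fin 7) (P0′ : Fin 7)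
                   (F  : FanoPlane) (τ  : Fin 7 → Fin 7) (P0  : Fin 7) : Set where
  field
    points      : Permutation′ 7
    lines       : Permutation′ 7
    incidence   : ∀ p t → inc F (points ⟨$⟩ʳ p) (lines ⟨$⟩ʳ t) ≡ inc F′ p t
    orientation : ∀ p q → eps τ P0 (points ⟨$⟩ʳ p) (points ⟨$⟩ʳ q) ≡ eps τ′ P0′ p q

  conjugate : (Fin 7 → Fin 7) → Fin 7 → Fin 7
  conjugate h = (points ⟨$⟩ʳ_) ∘ h ∘ (points ⟨$⟩ˡ_)

  incidence⁻¹ : ∀ P D → inc F′ (points ⟨$⟩ˡ P) (lines ⟨$⟩ˡ D) ≡ inc F P D
  incidence⁻¹ P D = trans (sym (incidence _ _)) (cong₂ (inc F) (inverseʳ points) (inverseʳ lines))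

  orientation⁻¹ : ∀ P Q → eps τ′ P0′ (points ⟨$⟩ˡ P) (points ⟨$⟩ˡ Q) ≡ eps τ P0 P Q
  orientation⁻¹ P Q = trans (sym (orientation _ _)) (cong₂ (eps τ P0) (inverseʳ points) (inverseʳ points))

  inverse : Isomorphism F τ P0 F′ τ′ P0′
  inverse = record
    { points = flip points ; lines = flip lines ; incidence = incidence⁻¹ ; orientation = orientation⁻¹ }

  pointFun-transport : ∀ P t → pointFun F P (lines ⟨$⟩ʳ t) ≡ pointFun F′ (points ⟨$⟩ˡ P) t
  pointFun-transport P t = cong (λ b → if b then Sign.+ else Sign.-)
    (trans (cong (λ R → inc F R (lines ⟨$⟩ʳ t)) (sym (inverseʳ points))) (incidence _ t))

  conjugate-isAut : ∀ {h} → IsAut F′ h → IsAut F (conjugate h)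
  conjugate-isAut {h} ((h-inj , _) , h-lines) = injective⇒bijective conj-inj , conj-lines
    where
    conj-inj : Injective _≡_ _≡_ (conjugate h)
    conj-inj eq = ⟨$⟩ˡ-injective points (h-inj (⟨$⟩ʳ-injective points eq))
    conj-lines : PreservesLines F (conjugate h)
    conj-lines D = lines ⟨$⟩ʳ E′ , λ P → begin
        inc F P D                                             ≡⟨ sym (incidence⁻¹ P D) ⟩
        inc F′ (points ⟨$⟩ˡ P) (lines ⟨$⟩ˡ D)                  ≡⟨ proj₂ (h-lines (lines ⟨$⟩ˡ D)) _ ⟩
        inc F′ (h (points ⟨$⟩ˡ P)) E′                           ≡⟨ sym (incidence _ _) ⟩
        inc F (conjugate h P) (lines ⟨$⟩ʳ E′)                  ∎
      where
      open ≡-Reasoning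
      E′ = proj₁ (h-lines (lines ⟨$⟩ˡ D))

  conjugate-deltaIs : ∀ {h f′ f} → (∀ t → f (lines ⟨$⟩ʳ t) ≡ f′ t) →
                      DeltaIs F′ τ′ P0′ h f′ → DeltaIs F τ P0 (conjugate h) f
  conjugate-deltaIs {h} {f′} {f} f≡f′ h-delta D P Q P≢Q P∈D Q∈D = begin
    eps τ P0 P Q *ˢ eps τ P0 (conjugate h P) (conjugate h Q)
      ≡⟨ cong₂ _*ˢ_ (sym (orientation⁻¹ P Q)) (orientation _ _) ⟩
    eps τ′ P0′ p q *ˢ eps τ′ P0′ (h p) (h q)
      ≡⟨ h-delta (lines ⟨$⟩ˡ D) p q (P≢Q ∘ ⟨$⟩ˡ-injective points) (on P∈D) (on Q∈D) ⟩
    f′ (lines ⟨$⟩ˡ D)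
      ≡⟨ sym (f≡f′ _) ⟩
    f (lines ⟨$⟩ʳ (lines ⟨$⟩ˡ D))
      ≡⟨ cong f (inverseʳ lines) ⟩
    f D ∎
    where
    open ≡-Reasoning
    p = points ⟨$⟩ˡ P
    q = points ⟨$⟩ˡ Q
    on : ∀ {R} → T (inc F R D) → T (inc F′ (points ⟨$⟩ˡ R) (lines ⟨$⟩ˡ D))
    on = subst T (sym (incidence⁻¹ _ D))

  conjugate-cong : ∀ {g h} → g ≐ h → conjugate g ≐ conjugate h
  conjugate-cong g≐h P = cong (points ⟨$⟩ʳ_) (g≐h _)

  conjugate-injective : ∀ {g h} → conjugate g ≐ conjugate h → g ≐ h
  conjugate-injective {g} {h} eq p = begin
    g p                             ≡⟨ cong g (sym (inverseˡ points)) ⟩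
    g (points ⟨$⟩ˡ (points ⟨$⟩ʳ p)) ≡⟨ ⟨$⟩ʳ-injective points (eq _) ⟩
    h (points ⟨$⟩ˡ (points ⟨$⟩ʳ p)) ≡⟨ cong h (inverseˡ points) ⟩
    h p                             ∎
    where open ≡-Reasoning

  conjugate-inverse : ∀ g → conjugate ((points ⟨$⟩ˡ_) ∘ g ∘ (points ⟨$⟩ʳ_)) ≐ g
  conjugate-inverse g P = trans (inverseʳ points) (cong g (inverseʳ points))

module _ {F′ τ′ P0′ F τ P0} (ι : Isomorphism F′ τ′ P0′ F τ P0) where
  open Isomorphism ι
  private module ι⁻¹ = Isomorphism inverse

  ExactlyN-transport : ∀ {n f′ f} → (∀ t → f (lines ⟨$⟩ʳ t) ≡ f′ t) →
                       ExactlyN n F′ τ′ P0′ f′ → ExactlyN n F τ P0 f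
  ExactlyN-transport {f′ = f′} {f} f≡f′ (gs , length≡n , solutions , distinct , complete) =
      map conjugate gs
    , trans (length-map conjugate gs) length≡n
    , All.map⁺ (All.map (λ (aut , delta) → conjugate-isAut aut , conjugate-deltaIs f≡f′ delta) solutions)
    , AllPairs.map⁺ (AllPairs.map (λ g≉h g≐h → g≉h (conjugate-injective g≐h)) distinct)
    , λ g aut delta → Any.map⁺ (Any.map (λ g′≐h P → trans (sym (conjugate-inverse g P)) (conjugate-cong g′≐h P))
                          (complete _ (ι⁻¹.conjugate-isAut aut) (ι⁻¹.conjugate-deltaIs f′≡f delta)))
    where
    f′≡f : ∀ D → f′ (lines ⟨$⟩ˡ D) ≡ f D
    f′≡f D = trans (sym (f≡f′ _)) (cong f (inverseʳ lines))

module Enumeration (F : FanoPlane) {third} (third-spec : IsThirdPoint F third)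
                   (base : Triple) (frame : Fin 7 → Word)
                   (frame-spans : ∀ x → evaluate third base (frame x) ≡ x) where

  extend : Triple → Fin 7 → Fin 7
  extend v x = evaluate third v (frame x)

  automorphism-extends : ∀ {h} → IsAut F h → h ≐ extend (map₃ h base)
  automorphism-extends {h} h-aut x =
    trans (cong h (sym (frame-spans x))) (automorphism-evaluate {F = F} third-spec h-aut base (frame x))

  candidates : List (Fin 7 → Fin 7)
  candidates = map extend (cartesianProduct (allFin 7) (cartesianProduct (allFin 7) (allFin 7)))

  IsSolution : (τ : Fin 7 → Fin 7) (P0 : Fin 7) (f : Fin 7 → Sign) → (Fin 7 → Fin 7) → Set
  IsSolution τ P0 f g = IsAut F g × DeltaIs F τ P0 g f

  solution? : ∀ τ P0 f g → Dec (IsSolution τ P0 f g)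
  solution? τ P0 f g = IsAut? F g ×-dec DeltaIs? F τ P0 g f

  solutions : (τ : Fin 7 → Fin 7) (P0 : Fin 7) (f : Fin 7 → Sign) → List (Fin 7 → Fin 7)
  solutions τ P0 f = filter (solution? τ P0 f) candidates

  Counted : ℕ → List (Fin 7 → Fin 7) → Set
  Counted n gs = length gs ≡ n × AllPairs (λ g h → ¬ (g ≐ h)) gs

  counted? : ∀ n gs → Dec (Counted n gs)
  counted? n gs = length gs ≟ℕ n ×-dec allPairs? (λ g h → ¬? (g ≐? h)) gs

  ExactlyN-by-enumeration : ∀ τ P0 f n → isYes (counted? n (solutions τ P0 f)) ≡ true → ExactlyN n F τ P0 f
  ExactlyN-by-enumeration τ P0 f n ok =
    solutions τ P0 f , length≡n , All.all-filter (solution? τ P0 f) candidates , distinct , complete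
    where
    length≡n = proj₁ (from-isYes _ ok)
    distinct = proj₂ (from-isYes _ ok)
    complete : ∀ g → IsAut F g → DeltaIs F τ P0 g f → Any (g ≐_) (solutions τ P0 f)
    complete g g-aut g-delta =
      Any.map (λ ext≡h → subst (g ≐_) ext≡h g≐ext)
              (∈-filter⁺ (solution? τ P0 f) ext∈candidates
                 (IsAut-resp-≐ F g≐ext g-aut , DeltaIs-resp-≐ F {τ} {P0} g≐ext g-delta))
      where
      g≐ext = automorphism-extends g-aut
      ext∈candidates =
        ∈-map⁺ extend (∈-cartesianProduct⁺ (∈-allFin _) (∈-cartesianProduct⁺ (∈-allFin _) (∈-allFin _)))

infixl 6 _⊕_ _⊖_

_⊕_ _⊖_ : Fin 7 → Fin 7 → Fin 7
p ⊕ q = fromℕ< (m%n<n (toℕ p + toℕ q) 7)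
p ⊖ q = fromℕ< (m%n<n (toℕ p + 7 ∸ toℕ q) 7)

ρ : Fin 7 → Fin 7
ρ p = p ⊕ 1F

⊕-injectiveˡ : ∀ r → Injective _≡_ _≡_ (_⊕ r)
⊕-injectiveˡ = from-isYes (all? λ r → injective? (_⊕ r)) refl

⊕-⊖-cancelʳ : ∀ p t r → (p ⊕ r) ⊖ (t ⊕ r) ≡ p ⊖ t
⊕-⊖-cancelʳ = from-isYes (all? λ p → all? λ t → all? λ r → (p ⊕ r) ⊖ (t ⊕ r) ≟ p ⊖ t) refl

0F⊕ : ∀ r → 0F ⊕ r ≡ r
0F⊕ = from-isYes (all? λ r → 0F ⊕ r ≟ r) refl

eps-ρ-⊕ : ∀ p q r → eps ρ 0F (p ⊕ r) (q ⊕ r) ≡ eps ρ 0F p q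
eps-ρ-⊕ = from-isYes
  (all? λ p → all? λ q → all? λ r → eps ρ 0F (p ⊕ r) (q ⊕ r) ≟ˢ eps ρ 0F p q) refl

⊕-⊖-inverse : ∀ t p → t ⊕ (p ⊖ t) ≡ p
⊕-⊖-inverse = from-isYes (all? λ t → all? λ p → t ⊕ (p ⊖ t) ≟ p) refl

index-ρ : ∀ p → index ρ 0F p ≡ toℕ p
index-ρ = from-isYes (all? λ p → index ρ 0F p ≟ℕ toℕ p) refl

block : Fin 7 → List (Fin 7)
block k = 0F ∷ 1F ∷ k ∷ []

cyclicInc : Fin 7 → Fin 7 → Fin 7 → Bool
cyclicInc k p t = isYes (p ⊖ t ∈? block k)

-- {0, 1, k} is a perfect difference set modulo 7 (every nonzero residue is the difference of
-- exactly one pair of its elements) precisely for k = 3 and k = 5.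
data PerfectDifferenceSet : Fin 7 → Set where
  perfect₃ : PerfectDifferenceSet 3F
  perfect₅ : PerfectDifferenceSet 5F

by-decision : {P : Fin 7 → Set} (P? : ∀ k → Dec (P k)) →
              isYes (P? 3F) ≡ true → isYes (P? 5F) ≡ true → ∀ {k} → PerfectDifferenceSet k → P k
by-decision P? yes₃ yes₅ perfect₃ = from-isYes (P? 3F) yes₃
by-decision P? yes₃ yes₅ perfect₅ = from-isYes (P? 5F) yes₅

three? : ∀ k → Dec (∀ D → length (filterᵇ (λ P → cyclicInc k P D) (allFin 7)) ≡ 3)
three? k = all? λ D → length (filterᵇ (λ P → cyclicInc k P D) (allFin 7)) ≟ℕ 3

unique? : ∀ k → Dec (∀ P Q → P ≢ Q → Σ (Fin 7) λ D → T (cyclicInc k P D) × T (cyclicInc k Q D) ×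
                       (∀ E → T (cyclicInc k P E) → T (cyclicInc k Q E) → E ≡ D))
unique? k = all? λ P → all? λ Q → ¬? (P ≟ Q) →-dec any? λ D →
  T? (cyclicInc k P D) ×-dec T? (cyclicInc k Q D) ×-dec
  all? λ E → T? (cyclicInc k P E) →-dec T? (cyclicInc k Q E) →-dec E ≟ D

cyclicPlane : ∀ {k} → PerfectDifferenceSet k → FanoPlane
cyclicPlane {k} d = record
  { inc = cyclicInc k ; three = by-decision three? refl refl d ; unique = by-decision unique? refl refl d }

PartialLinear : (Fin 7 → Fin 7 → Bool) → Set
PartialLinear inc = ∀ {p q s t} → p ≢ q → T (inc p s) → T (inc q s) → T (inc p t) → T (inc q t) →
                    ∀ r → inc r s ≡ inc r t

-- For k = 2, 4, 6 some difference occurs twice in {0, 1, k}, so two translates share two points.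
perfect-difference-set : ∀ {k} → k ≢ 0F → k ≢ 1F → PartialLinear (cyclicInc k) → PerfectDifferenceSet k
perfect-difference-set {0F} k≢0 _ _ = contradiction refl k≢0
perfect-difference-set {1F} _ k≢1 _ = contradiction refl k≢1
perfect-difference-set {2F} _ _ linear = contradiction (linear {1F} {2F} {0F} {1F} (λ ()) _ _ _ _ 0F) λ ()
perfect-difference-set {3F} _ _ _      = perfect₃
perfect-difference-set {4F} _ _ linear = contradiction (linear {1F} {4F} {0F} {4F} (λ ()) _ _ _ _ 0F) λ ()
perfect-difference-set {5F} _ _ _      = perfect₅
perfect-difference-set {6F} _ _ linear = contradiction (linear {0F} {1F} {0F} {1F} (λ ()) _ _ _ _ 6F) λ ()

translates-distinct? : ∀ k → Dec (∀ s t → (∀ r → cyclicInc k r s ≡ cyclicInc k r t) → s ≡ t)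
translates-distinct? k =
  all? λ s → all? λ t → (all? λ r → cyclicInc k r s ≟ᵇ cyclicInc k r t) →-dec s ≟ t

translates-distinct : ∀ {k} → PerfectDifferenceSet k →
                      ∀ s t → (∀ r → cyclicInc k r s ≡ cyclicInc k r t) → s ≡ t
translates-distinct = by-decision translates-distinct? refl refl

-- `offset d δ` is the third point on the line through 0 and δ; translating by p gives the third
-- point on the line through p and p ⊕ δ. This table lookup keeps the enumeration below cheap.
offset : ∀ {k} → PerfectDifferenceSet k → Fin 7 → Fin 7
offset perfect₃ = Vec.lookup (0F ∷ 3F ∷ 6F ∷ 1F ∷ 5F ∷ 4F ∷ 2F ∷ [])
offset perfect₅ = Vec.lookup (0F ∷ 5F ∷ 3F ∷ 2F ∷ 6F ∷ 1F ∷ 4F ∷ [])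

cyclicThird : ∀ {k} → PerfectDifferenceSet k → Fin 7 → Fin 7 → Fin 7
cyclicThird d p q = p ⊕ offset d (q ⊖ p)

cyclicThird-spec : ∀ {k} (d : PerfectDifferenceSet k) → IsThirdPoint (cyclicPlane d) (cyclicThird d)
cyclicThird-spec perfect₃ = from-isYes (isThirdPoint? (cyclicPlane perfect₃) (cyclicThird perfect₃)) refl
cyclicThird-spec perfect₅ = from-isYes (isThirdPoint? (cyclicPlane perfect₅) (cyclicThird perfect₅)) refl

base : Triple
base = 0F , 1F , 2F

frame : ∀ {k} → PerfectDifferenceSet k → Fin 7 → Word
frame perfect₃ = Vec.lookup
  (gen₀ ∷ gen₁ ∷ gen₂ ∷ gen₀ ∙ gen₁ ∷ gen₁ ∙ gen₂ ∷ gen₀ ∙ (gen₁ ∙ gen₂) ∷ gen₀ ∙ gen₂ ∷ [])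
frame perfect₅ = Vec.lookup
  (gen₀ ∷ gen₁ ∷ gen₂ ∷ gen₀ ∙ gen₂ ∷ gen₀ ∙ (gen₁ ∙ gen₂) ∷ gen₀ ∙ gen₁ ∷ gen₁ ∙ gen₂ ∷ [])

frame-spans : ∀ {k} (d : PerfectDifferenceSet k) x → evaluate (cyclicThird d) base (frame d x) ≡ x
frame-spans perfect₃ =
  from-isYes (all? λ x → evaluate (cyclicThird perfect₃) base (frame perfect₃ x) ≟ x) refl
frame-spans perfect₅ =
  from-isYes (all? λ x → evaluate (cyclicThird perfect₅) base (frame perfect₅ x) ≟ x) refl

module CyclicEnumeration {k} (d : PerfectDifferenceSet k) =
  Enumeration (cyclicPlane d) (cyclicThird-spec d) base (frame d) (frame-spans d)

cyclic-counts₀ : ∀ {k} (d : PerfectDifferenceSet k) →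
                 ExactlyN 21 (cyclicPlane d) ρ 0F constPlus ×
                 ExactlyN 21 (cyclicPlane d) ρ 0F (pointFun (cyclicPlane d) 0F)
cyclic-counts₀ perfect₃ = E.ExactlyN-by-enumeration ρ 0F constPlus 21 refl
                , E.ExactlyN-by-enumeration ρ 0F (pointFun (cyclicPlane perfect₃) 0F) 21 refl
  where module E = CyclicEnumeration perfect₃
cyclic-counts₀ perfect₅ = E.ExactlyN-by-enumeration ρ 0F constPlus 21 refl
                , E.ExactlyN-by-enumeration ρ 0F (pointFun (cyclicPlane perfect₅) 0F) 21 refl
  where module E = CyclicEnumeration perfect₅

rotation : ∀ {k} (d : PerfectDifferenceSet k) (r : Fin 7) →
           Isomorphism (cyclicPlane d) ρ 0F (cyclicPlane d) ρ 0F
rotation {k} d r = record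
  { points      = translation
  ; lines       = translation
  ; incidence   = λ p t → cong (λ s → isYes (s ∈? block k)) (⊕-⊖-cancelʳ p t r)
  ; orientation = λ p q → eps-ρ-⊕ p q r
  }
  where translation = injective⇒permutation (⊕-injectiveˡ r)

cyclic-counts : ∀ {k} (d : PerfectDifferenceSet k) →
                ExactlyN 21 (cyclicPlane d) ρ 0F constPlus ×
                (∀ r → ExactlyN 21 (cyclicPlane d) ρ 0F (pointFun (cyclicPlane d) r))
cyclic-counts {k} d =
  proj₁ (cyclic-counts₀ d) , λ r → ExactlyN-transport (rotation d r) (translate r) (proj₂ (cyclic-counts₀ d))
  where
  translate : ∀ r t → pointFun (cyclicPlane d) r (t ⊕ r) ≡ pointFun (cyclicPlane d) 0F t
  translate r t = cong (λ s → if isYes (s ∈? block k) then Sign.+ else Sign.-)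
                       (trans (cong (_⊖ (t ⊕ r)) (sym (0F⊕ r))) (⊕-⊖-cancelʳ 0F t r))

module _ (τ : Fin 7 → Fin 7) where

  iter-+ : ∀ m n x → iter (m + n) τ x ≡ iter m τ (iter n τ x)
  iter-+ zero    n x = refl
  iter-+ (suc m) n x = cong τ (iter-+ m n x)

  iter-τ : ∀ n x → iter n τ (τ x) ≡ τ (iter n τ x)
  iter-τ zero    x = refl
  iter-τ (suc n) x = cong τ (iter-τ n x)

  iter-fixed : ∀ {x} → τ x ≡ x → ∀ n → iter n τ x ≡ x
  iter-fixed τx≡x zero    = refl
  iter-fixed τx≡x (suc n) = trans (cong τ (iter-fixed τx≡x n)) τx≡x

  iter-injective : Injective _≡_ _≡_ τ → ∀ n → Injective _≡_ _≡_ (iter n τ)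
  iter-injective τ-inj zero    eq = eq
  iter-injective τ-inj (suc n) eq = iter-injective τ-inj n (τ-inj eq)

module Order7 {τ : Fin 7 → Fin 7} (τ-injective : Injective _≡_ _≡_ τ) (order : HasOrder7 τ)
              (P0 : Fin 7) where

  iter-*7 : ∀ q x → iter (q * 7) τ x ≡ x
  iter-*7 zero    x = refl
  iter-*7 (suc q) x = trans (iter-+ τ 7 (q * 7) x) (trans (cong (iter 7 τ) (iter-*7 q x)) (proj₁ order x))

  iter-%7 : ∀ n x → iter n τ x ≡ iter (n % 7) τ x
  iter-%7 n x = begin
    iter n τ x                                    ≡⟨ cong (λ m → iter m τ x) (m≡m%n+[m/n]*n n 7) ⟩
    iter (n % 7 + (n / 7) * 7) τ x                ≡⟨ iter-+ τ (n % 7) _ x ⟩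
    iter (n % 7) τ (iter ((n / 7) * 7) τ x)       ≡⟨ cong (iter (n % 7) τ) (iter-*7 (n / 7) x) ⟩
    iter (n % 7) τ x                              ∎
    where open ≡-Reasoning

  iter-*-fixed : ∀ {d x} → iter d τ x ≡ x → ∀ m → iter (m * d) τ x ≡ x
  iter-*-fixed fixed zero    = refl
  iter-*-fixed {d} {x} fixed (suc m) =
    trans (iter-+ τ d (m * d) x) (trans (cong (iter d τ) (iter-*-fixed fixed m)) fixed)

  inverse-power : ∀ {x} d e → 1 ≡ (e * d) % 7 → iter d τ x ≡ x → τ x ≡ x
  inverse-power {x} d e 1≡ed fixed = begin
    τ x                      ≡⟨ cong (λ n → iter n τ x) 1≡ed ⟩
    iter ((e * d) % 7) τ x   ≡⟨ iter-%7 (e * d) x ⟨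
    iter (e * d) τ x         ≡⟨ iter-*-fixed fixed e ⟩
    x                        ∎
    where open ≡-Reasoning

  -- 7 is prime, so every 1 ≤ d < 7 has an inverse e modulo 7.
  power-fixed⇒fixed : ∀ {d x} → 1 ≤ d → d < 7 → iter d τ x ≡ x → τ x ≡ x
  power-fixed⇒fixed {1} _ _ = inverse-power 1 1 refl
  power-fixed⇒fixed {2} _ _ = inverse-power 2 4 refl
  power-fixed⇒fixed {3} _ _ = inverse-power 3 5 refl
  power-fixed⇒fixed {4} _ _ = inverse-power 4 2 refl
  power-fixed⇒fixed {5} _ _ = inverse-power 5 3 refl
  power-fixed⇒fixed {6} _ _ = inverse-power 6 6 refl
  power-fixed⇒fixed {suc (suc (suc (suc (suc (suc (suc _))))))} _ (s≤s (s≤s (s≤s (s≤s (s≤s (s≤s (s≤s ())))))))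

  collision⇒fixed : ∀ {i j x} → i < j → j < 7 → iter i τ x ≡ iter j τ x → τ x ≡ x
  collision⇒fixed {i} {j} {x} i<j j<7 τⁱx≡τʲx =
    iter-injective τ τ-injective i (trans (iter-τ τ i x) τy≡y)
    where
    τy≡y : τ (iter i τ x) ≡ iter i τ x
    τy≡y = power-fixed⇒fixed (m<n⇒0<n∸m i<j) (≤-<-trans (m∸n≤m j i) j<7) (begin
      iter (j ∸ i) τ (iter i τ x) ≡⟨ iter-+ τ (j ∸ i) i x ⟨
      iter (j ∸ i + i) τ x        ≡⟨ cong (λ n → iter n τ x) (m∸n+n≡m (<⇒≤ i<j)) ⟩
      iter j τ x                  ≡⟨ τⁱx≡τʲx ⟨
      iter i τ x                  ∎)
      where open ≡-Reasoning

  -- The orbit of Q under τ misses the fixed point y, so by pigeonhole it repeats within 7 steps.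
  fixed-point-elsewhere⇒fixed : ∀ {y Q} → τ y ≡ y → Q ≢ y → τ Q ≡ Q
  fixed-point-elsewhere⇒fixed {y} {Q} τy≡y Q≢y =
    let i , j , i<j , eq = pigeonhole (n<1+n 6) (λ i → punchOut (avoids i))
    in collision⇒fixed i<j (toℕ<n j) (punchOut-injective (avoids i) (avoids j) eq)
    where
    avoids : ∀ (i : Fin 7) → y ≢ iter (toℕ i) τ Q
    avoids i y≡τⁱQ =
      Q≢y (iter-injective τ τ-injective (toℕ i) (trans (sym y≡τⁱQ) (sym (iter-fixed τ τy≡y (toℕ i)))))

  τ-fixes-nothing : ∀ y → τ y ≢ y
  τ-fixes-nothing y τy≡y = proj₂ order 1 (s≤s z≤n) (s≤s (s≤s z≤n)) all-fixed
    where
    all-fixed : ∀ Q → τ Q ≡ Q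
    all-fixed Q with Q ≟ y
    ... | yes refl = τy≡y
    ... | no Q≢y = fixed-point-elsewhere⇒fixed τy≡y Q≢y

  orbit : Fin 7 → Fin 7
  orbit i = iter (toℕ i) τ P0

  orbit-injective : Injective _≡_ _≡_ orbit
  orbit-injective {i} {j} eq with <-cmpᶠ i j
  ... | tri< i<j _ _ = contradiction (collision⇒fixed i<j (toℕ<n j) eq) (τ-fixes-nothing P0)
  ... | tri≈ _ i≡j _ = i≡j
  ... | tri> _ _ j<i = contradiction (collision⇒fixed j<i (toℕ<n i) (sym eq)) (τ-fixes-nothing P0)

  orbit-⊕ : ∀ t s → iter (toℕ t) τ (orbit s) ≡ orbit (t ⊕ s)
  orbit-⊕ t s = begin
    iter (toℕ t) τ (orbit s)          ≡⟨ iter-+ τ (toℕ t) (toℕ s) P0 ⟨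
    iter (toℕ t + toℕ s) τ P0         ≡⟨ iter-%7 (toℕ t + toℕ s) P0 ⟩
    iter ((toℕ t + toℕ s) % 7) τ P0   ≡⟨ cong (λ n → iter n τ P0) (toℕ-fromℕ< (m%n<n (toℕ t + toℕ s) 7)) ⟨
    orbit (t ⊕ s)                     ∎
    where open ≡-Reasoning

  -- `index` scans τ⁰ P0, …, τ⁶ P0; we follow its seven comparisons.
  index-orbit : ∀ j → index τ P0 (orbit j) ≡ toℕ j
  index-orbit j with iter 0 τ P0 ≟ orbit j
  ... | yes hit = cong toℕ (orbit-injective {0F} hit)
  ... | no miss₀ with iter 1 τ P0 ≟ orbit j
  ... | yes hit = cong toℕ (orbit-injective {1F} hit)
  ... | no miss₁ with iter 2 τ P0 ≟ orbit j
  ... | yes hit = cong toℕ (orbit-injective {2F} hit)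
  ... | no miss₂ with iter 3 τ P0 ≟ orbit j
  ... | yes hit = cong toℕ (orbit-injective {3F} hit)
  ... | no miss₃ with iter 4 τ P0 ≟ orbit j
  ... | yes hit = cong toℕ (orbit-injective {4F} hit)
  ... | no miss₄ with iter 5 τ P0 ≟ orbit j
  ... | yes hit = cong toℕ (orbit-injective {5F} hit)
  ... | no miss₅ with iter 6 τ P0 ≟ orbit j
  ... | yes hit = cong toℕ (orbit-injective {6F} hit)
  ... | no miss₆ = ⊥-elim (missed (toℕ j) (toℕ<n j) refl)
    where
    missed : ∀ i → i < 7 → iter i τ P0 ≢ orbit j
    missed 0 _ = miss₀
    missed 1 _ = miss₁
    missed 2 _ = miss₂
    missed 3 _ = miss₃
    missed 4 _ = miss₄
    missed 5 _ = miss₅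
    missed 6 _ = miss₆
    missed (suc (suc (suc (suc (suc (suc (suc _))))))) (s≤s (s≤s (s≤s (s≤s (s≤s (s≤s (s≤s ())))))))

module CyclicStructure (F : FanoPlane) (τ : Fin 7 → Fin 7) (P0 : Fin 7) (oriented : IsOrientation F τ) where

  private
    τ-aut = proj₁ oriented
  open Order7 (proj₁ (proj₁ τ-aut)) (proj₂ oriented) P0

  τ-line : Fin 7 → Fin 7
  τ-line D = proj₁ (proj₂ τ-aut D)

  iter-incidence : ∀ n P D → inc F (iter n τ P) (iter n τ-line D) ≡ inc F P D
  iter-incidence zero    P D = refl
  iter-incidence (suc n) P D =
    trans (sym (proj₂ (proj₂ τ-aut (iter n τ-line D)) (iter n τ P))) (iter-incidence n P D)

  orbits : Permutation′ 7
  orbits = injective⇒permutation orbit-injective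

  orbit-distinct : ∀ {i j} → i ≢ j → orbit i ≢ orbit j
  orbit-distinct i≢j = i≢j ∘ orbit-injective

  orbit₀≢orbit₁ : orbit 0F ≢ orbit 1F
  orbit₀≢orbit₁ = orbit-distinct {0F} {1F} λ ()

  D₀ : Fin 7
  D₀ = proj₁ (unique F (orbit 0F) (orbit 1F) orbit₀≢orbit₁)

  0∈D₀ : T (inc F (orbit 0F) D₀)
  0∈D₀ = proj₁ (proj₂ (unique F (orbit 0F) (orbit 1F) orbit₀≢orbit₁))

  1∈D₀ : T (inc F (orbit 1F) D₀)
  1∈D₀ = proj₁ (proj₂ (proj₂ (unique F (orbit 0F) (orbit 1F) orbit₀≢orbit₁)))

  third-point : ∃ λ k → T (inc F (orbit k) D₀) × k ≢ 0F × k ≢ 1F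
  third-point =
    let c , c∈D₀ , c≢0 , c≢1 = line-has-third-point F orbit₀≢orbit₁ 0∈D₀ 1∈D₀
        k = orbits ⟨$⟩ˡ c
        orbit-k≡c : orbit k ≡ c
        orbit-k≡c = inverseʳ orbits
    in k , subst (λ R → T (inc F R D₀)) (sym orbit-k≡c) c∈D₀
         , (λ k≡0 → c≢0 (trans (sym orbit-k≡c) (cong orbit k≡0)))
         , (λ k≡1 → c≢1 (trans (sym orbit-k≡c) (cong orbit k≡1)))

  -- k is a module parameter rather than the index computed in `third-point`: matching on
  -- `s ∈? block k` would otherwise make Agda normalise the inverse-permutation search behind k.
  module WithThirdPoint (k : Fin 7) (k∈D₀ : T (inc F (orbit k) D₀)) (k≢0 : k ≢ 0F) (k≢1 : k ≢ 1F) where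

    D₀-incidence : ∀ s → inc F (orbit s) D₀ ≡ isYes (s ∈? block k)
    D₀-incidence s with s ∈? block k
    ... | yes (here refl)                 = Equivalence.to T-≡ 0∈D₀
    ... | yes (there (here refl))         = Equivalence.to T-≡ 1∈D₀
    ... | yes (there (there (here refl))) = Equivalence.to T-≡ k∈D₀
    ... | no s∉block = ¬T⇒≡false (line-has-no-fourth-point F
            orbit₀≢orbit₁ (orbit-distinct (k≢0 ∘ sym)) (orbit-distinct (k≢1 ∘ sym))
            (orbit-distinct (s∉block ∘ here)) (orbit-distinct (s∉block ∘ there ∘ here))
            (orbit-distinct (s∉block ∘ there ∘ there ∘ here)) 0∈D₀ 1∈D₀ k∈D₀)

    L : Fin 7 → Fin 7
    L t = iter (toℕ t) τ-line D₀

    orbit-incidence : ∀ p t → inc F (orbit p) (L t) ≡ cyclicInc k p t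
    orbit-incidence p t = begin
      inc F (orbit p) (L t)                                ≡⟨ cong (λ R → inc F R (L t)) shift ⟩
      inc F (iter (toℕ t) τ (orbit (p ⊖ t))) (L t)         ≡⟨ iter-incidence (toℕ t) _ D₀ ⟩
      inc F (orbit (p ⊖ t)) D₀                             ≡⟨ D₀-incidence (p ⊖ t) ⟩
      cyclicInc k p t                                      ∎
      where
      open ≡-Reasoning
      shift : orbit p ≡ iter (toℕ t) τ (orbit (p ⊖ t))
      shift = sym (trans (orbit-⊕ t (p ⊖ t)) (cong orbit (⊕-⊖-inverse t p)))

    cyclic-partial-linear : PartialLinear (cyclicInc k)
    cyclic-partial-linear {p} {q} {s} {t} p≢q p∈s q∈s p∈t q∈t r = begin
      cyclicInc k r s           ≡⟨ orbit-incidence r s ⟨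
      inc F (orbit r) (L s)     ≡⟨ cong (inc F (orbit r)) Ls≡Lt ⟩
      inc F (orbit r) (L t)     ≡⟨ orbit-incidence r t ⟩
      cyclicInc k r t           ∎
      where
      open ≡-Reasoning
      on : ∀ {x u} → T (cyclicInc k x u) → T (inc F (orbit x) (L u))
      on {x} {u} = subst T (sym (orbit-incidence x u))
      Ls≡Lt : L s ≡ L t
      Ls≡Lt = lines-through-two-points-coincide F (orbit-distinct p≢q)
                (on {p} {s} p∈s) (on {q} {s} q∈s) (on {p} {t} p∈t) (on {q} {t} q∈t)

    perfect : PerfectDifferenceSet k
    perfect = perfect-difference-set k≢0 k≢1 λ {p} {q} {s} {t} → cyclic-partial-linear {p} {q} {s} {t}

    L-injective : Injective _≡_ _≡_ L
    L-injective {s} {t} Ls≡Lt = translates-distinct perfect s t λ r →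
      trans (sym (orbit-incidence r s)) (trans (cong (inc F (orbit r)) Ls≡Lt) (orbit-incidence r t))

    isomorphism : Isomorphism (cyclicPlane perfect) ρ 0F F τ P0
    isomorphism = record
      { points      = orbits
      ; lines       = injective⇒permutation L-injective
      ; incidence   = orbit-incidence
      ; orientation = λ p q → cong₂ (λ i j → signOfDiff ((j + 7 ∸ i) % 7)) (index-agrees p) (index-agrees q)
      }
      where
      index-agrees : ∀ r → index τ P0 (orbit r) ≡ index ρ 0F r
      index-agrees r = trans (index-orbit r) (sym (index-ρ r))

  open WithThirdPoint (proj₁ third-point) (proj₁ (proj₂ third-point))
                      (proj₁ (proj₂ (proj₂ third-point))) (proj₂ (proj₂ (proj₂ third-point))) public

corollary2p34 : (F : FanoPlane) (τ : Fin 7 → Fin 7) (P0 : Fin 7) →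
    IsOrientation F τ →
    ExactlyN 21 F τ P0 constPlus × (∀ (P : Fin 7) → ExactlyN 21 F τ P0 (pointFun F P))
corollary2p34 F τ P0 oriented =
    ExactlyN-transport isomorphism (λ _ → refl) (proj₁ (cyclic-counts perfect))
  , λ P → ExactlyN-transport isomorphism (pointFun-transport P)
                               (proj₂ (cyclic-counts perfect) (points ⟨$⟩ˡ P))
  where
  open CyclicStructure F τ P0 oriented
  open Isomorphism isomorphism using (points; pointFun-transport)
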